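{- Let $G$ be a tree rooted at $r$, let $u\in V(G)$, and let $\sigma$ be a configuration that is local terminal in $\mathrm{subtree}(v)$ for every child $v$ of $u$ (i.e., $\sigma_w<\deg(w)$ for all $w\in\mathrm{subtree}(v)$). Define $\psi_u(k)=\sigma_u-k\cdot\deg(u)+\sum_{v\in\mathrm{children}(u)}\delta(v,k)$. Then $\psi_u(k)\ge\psi_u(k+1)$ for all $k\in\mathbb{N}$.
   Context: Sandpile on a tree: $\sigma\in\mathbb{N}^{V(G)}$ gives chip counts; vertex $v$ is full if $\sigma_v\ge\deg(v)$; firing $v$ decreases $\sigma_v$ by $\deg(v)$ and adds one chip to each neighbor. $\mathrm{subtree}(v)$ is the vertex set of the subtree rooted at $v$ (including $v$), $\mathrm{parent}(v)$ its parent, $\mathrm{children}(u)$ the children of $u$. For a configuration $\tau$, $\mathrm{final}(\tau,v)$ is obtained by repeatedly firing full vertices of $\mathrm{subtree}(v)$ until none of them is full (well defined, order independent). For a non-root $v$ and $\sigma$ local terminal in $\mathrm{subtree}(v)$, $\delta(v,x)=\mathrm{final}(\sigma+x e_v,v)_{\mathrm{parent}(v)}-\mathrm{final}(\sigma,v)_{\mathrm{parent}(v)}$ for integers $x\ge0$, with $e_v$ the indicator vector of $v$. -}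

module Defs where

open import Data.Nat using (ℕ; zero; suc; _+_; _∸_; _≤_; _<_)
open import Data.Fin using (Fin; zero; suc; _≟_)
open import Data.Integer as ℤ using (ℤ; +_)
open import Data.Bool using (Bool; true; false; if_then_else_; _∧_; _∨_; not)
open import Data.Product using (Σ; ∃; _×_; _,_)
open import Relation.Nullary using (does; ¬_)
open import Relation.Binary.PropositionalEquality using (_≡_)
open import Function using (_∘_)

iter : {A : Set} → (A → A) → ℕ → A → A
iter f zero    a = a
iter f (suc k) a = f (iter f k a)

-- Convention: parent root ≡ root (the root has no real parent); every vertex
-- reaches the root by iterating parent (so the graph has no cycles and is
-- connected). Edges are {v , parent v} for v ≠ root.
record RootedTree (n : ℕ) : Set where
  field
    root        : Fin n
    parent      : Fin n → Fin n
    parent-root : parent root ≡ root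
    reaches     : ∀ v → ∃ λ k → iter parent k v ≡ root

module _ {n : ℕ} (T : RootedTree n) where
  open RootedTree T

  Config : Set
  Config = Fin n → ℕ

  eqb : Fin n → Fin n → Bool
  eqb a b = does (a ≟ b)

  isChildb : Fin n → Fin n → Bool
  isChildb u w = not (eqb w root) ∧ eqb (parent w) u

  adjb : Fin n → Fin n → Bool
  adjb a b = isChildb a b ∨ isChildb b a

  sumℕ : ∀ {m} → (Fin m → ℕ) → ℕ
  sumℕ {zero}  f = 0
  sumℕ {suc m} f = f zero + sumℕ (f ∘ suc)

  sumℤ : ∀ {m} → (Fin m → ℤ) → ℤ
  sumℤ {zero}  f = + 0
  sumℤ {suc m} f = f zero ℤ.+ sumℤ (f ∘ suc)

  deg : Fin n → ℕ
  deg v = sumℕ (λ w → if adjb v w then 1 else 0)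

  InSubtree : Fin n → Fin n → Set
  InSubtree v w = ∃ λ k → iter parent k w ≡ v

  fire : Fin n → Config → Config
  fire w τ z = if eqb z w then τ z ∸ deg w
               else (if adjb z w then suc (τ z) else τ z)

  addAt : Config → ℕ → Fin n → Config
  addAt τ x v z = if eqb z v then τ z + x else τ z

  data Reach (v : Fin n) : Config → Config → Set where
    done : ∀ {τ} → Reach v τ τ
    step : ∀ {τ τ'} w → InSubtree v w → deg w ≤ τ w →
           Reach v (fire w τ) τ' → Reach v τ τ'

  LocalTerminal : Fin n → Config → Set
  LocalTerminal v τ = ∀ w → InSubtree v w → τ w < deg w

  IsFinal : Fin n → Config → Config → Set
  IsFinal v τ τ' = Reach v τ τ' × LocalTerminal v τ'

  -- δ(v,x) computed from given final configurations:
  -- finx = final(σ + x e_v , v), fin0 = final(σ , v)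
  δ : Fin n → Config → Config → ℤ
  δ v finx fin0 = + finx (parent v) ℤ.- + fin0 (parent v)

  -- ψ_u(k) = σ_u − k·deg(u) + Σ_{v child of u} δ(v,k)
  -- fin v k = final(σ + k e_v , v), fin0 v = final(σ , v)
  ψ : Config → Fin n → (Fin n → ℕ → Config) → (Fin n → Config) → ℕ → ℤ
  ψ σ u fin fin0 k =
    + σ u ℤ.- + (k Data.Nat.* deg u)
    ℤ.+ sumℤ (λ v → if isChildb u v then δ v (fin v k) (fin0 v) else + 0)

{-# OPTIONS --safe #-}
module Submission where

-- Let p be the parent of a child v of u. Chips fired inside subtree(v) reach p only
-- through v, so final(τ, v)_p = τ_p + (number of times v fires). If τ stabilises in
-- subtree(v) with firing vector c, then from τ + e_v firing c + 1 everywhere except at p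
-- also stabilises subtree(v): every vertex gets back one chip per neighbour, the
-- chip that p does not send to v being the added one. By the least action principle
-- v therefore fires at most once more, i.e. δ(v, k+1) ≤ δ(v, k) + 1, and
-- ψ_u(k+1) − ψ_u(k) ≤ #children(u) − deg(u) ≤ 0. The terms final(σ, v) cancel in
-- δ(v, k+1) − δ(v, k).

open import Defs
open import Data.Nat using (ℕ; zero; suc; _+_; _*_; _∸_; z≤n)
  renaming (_≤_ to _≤ℕ_; _<_ to _<ℕ_)
import Data.Nat.Properties as ℕ
open import Data.Nat.Solver using (module +-*-Solver)
open import Data.Fin using (Fin; zero; suc; _≟_)
open import Data.Bool using (true; false; if_then_else_; _∧_; _∨_; not)
open import Data.Bool.Properties using (∨-comm; if-eta)
open import Data.Integer as ℤ using (ℤ; _≤_)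
import Data.Integer.Properties as ℤ
import Data.Integer.Solver as ℤSolver
open import Data.Product using (_,_; proj₁; proj₂)
open import Relation.Nullary using (yes; no; does; ¬_; contradiction)
open import Relation.Nullary.Decidable using (dec-true; dec-false)
open import Relation.Binary.PropositionalEquality
open import Function using (_∘_)

iter-suc : ∀ {A : Set} (f : A → A) k a → iter f (suc k) a ≡ iter f k (f a)
iter-suc f zero    a = refl
iter-suc f (suc k) a = cong f (iter-suc f k a)

iter-+ : ∀ {A : Set} (f : A → A) j k a → iter f (j + k) a ≡ iter f j (iter f k a)
iter-+ f zero    k a = refl
iter-+ f (suc j) k a = cong f (iter-+ f j k a)

one-more-round : ∀ {a d c t x i y} → a <ℕ d → a + c * d ≡ t + i → y + x ≡ d →
  (t + x) + (i + y) <ℕ suc (c + 1) * d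
one-more-round {a} {d} {c} {t} {x} {i} {y} a<d balance complement = begin-strict
  (t + x) + (i + y)   ≡⟨ solve 4 (λ t x i y → (t :+ x) :+ (i :+ y) := (t :+ i) :+ (y :+ x)) refl t x i y ⟩
  (t + i) + (y + x)   ≡⟨ cong₂ _+_ (sym balance) complement ⟩
  (a + c * d) + d     <⟨ ℕ.+-monoˡ-< d (ℕ.+-monoˡ-< (c * d) a<d) ⟩
  (d + c * d) + d     ≡⟨ solve 2 (λ c d → (d :+ c :* d) :+ d := d :+ (c :+ con 1) :* d) refl c d ⟩
  suc (c + 1) * d     ∎
  where
  open ℕ.≤-Reasoning
  open +-*-Solver

module _ {n : ℕ} (T : RootedTree n) where
  open RootedTree T

  iter-parent-root : ∀ k → iter parent k root ≡ root
  iter-parent-root zero    = refl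
  iter-parent-root (suc k) = trans (cong parent (iter-parent-root k)) parent-root

  periodic⇒root : ∀ {v} j → iter parent (suc j) v ≡ v → v ≡ root
  periodic⇒root {v} j cycle with reaches v
  ... | m , reach = begin
    v                                     ≡⟨ sym (iter-multiple m) ⟩
    iter parent (m * suc j) v             ≡⟨ cong (λ t → iter parent t v) m*suc-j ⟩
    iter parent (m * j + m) v             ≡⟨ iter-+ parent (m * j) m v ⟩
    iter parent (m * j) (iter parent m v) ≡⟨ cong (iter parent (m * j)) reach ⟩
    iter parent (m * j) root              ≡⟨ iter-parent-root (m * j) ⟩
    root                                  ∎
    where
    open ≡-Reasoning
    iter-multiple : ∀ i → iter parent (i * suc j) v ≡ v
    iter-multiple zero    = refl
    iter-multiple (suc i) = trans (iter-+ parent (suc j) (i * suc j) v)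
                                  (trans (cong (iter parent (suc j)) (iter-multiple i)) cycle)
    m*suc-j : m * suc j ≡ m * j + m
    m*suc-j = trans (ℕ.*-suc m j) (ℕ.+-comm m (m * j))

  parent∉subtree : ∀ {v} → v ≢ root → ¬ InSubtree T v (parent v)
  parent∉subtree {v} v≢root (j , reach) = v≢root (periodic⇒root j (trans (iter-suc parent j v) reach))

  isChild⇒nonroot : ∀ {a b} → isChildb T a b ≡ true → b ≢ root
  isChild⇒nonroot {b = b} child with b ≟ root
  ... | no b≢root = b≢root

  isChild⇒parent : ∀ {a b} → isChildb T a b ≡ true → parent b ≡ a
  isChild⇒parent {a} {b} child with b ≟ root | parent b ≟ a
  ... | no _ | yes parent≡a = parent≡a

  parent-isChild : ∀ {v} → v ≢ root → isChildb T (parent v) v ≡ true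
  parent-isChild {v} v≢root =
    cong₂ (λ b c → not b ∧ c) (dec-false (v ≟ root) v≢root) (dec-true (parent v ≟ parent v) refl)

  isChild-irrefl : ∀ w → isChildb T w w ≡ false
  isChild-irrefl w with w ≟ root
  ... | yes _ = refl
  ... | no w≢root = cong (not false ∧_) (dec-false (parent w ≟ w) (w≢root ∘ periodic⇒root 0))

  adj-irrefl : ∀ w → adjb T w w ≡ false
  adj-irrefl w = cong₂ _∨_ (isChild-irrefl w) (isChild-irrefl w)

  adj-sym : ∀ a b → adjb T a b ≡ adjb T b a
  adj-sym a b = ∨-comm (isChildb T a b) (isChildb T b a)

  parent-adj : ∀ {v} → v ≢ root → adjb T (parent v) v ≡ true
  parent-adj {v} v≢root = cong (_∨ isChildb T v (parent v)) (parent-isChild v≢root)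

  -- If w ∈ subtree(v) were adjacent to p = parent v with w ≠ v, then either p would be a
  -- child of w or w would be a strict descendant of v with parent p; both put p in subtree(v).
  subtree-adj-parent : ∀ {v w} → v ≢ root → InSubtree T v w → adjb T (parent v) w ≡ true → w ≡ v
  subtree-adj-parent {v} {w} v≢root (j , reach) adj with isChildb T (parent v) w in child
  ... | true with j
  ...   | zero   = reach
  ...   | suc j′ = contradiction (j′ , trans (cong (iter parent j′) (sym (isChild⇒parent child)))
                                              (trans (sym (iter-suc parent j′ w)) reach))
                                 (parent∉subtree v≢root)
  subtree-adj-parent {v} {w} v≢root (j , reach) adj | false =
    contradiction (suc j , trans (iter-suc parent j (parent v))
                                 (trans (cong (iter parent j) (isChild⇒parent adj)) reach))
                  (parent∉subtree v≢root)

  sum-cong : ∀ {m} {f g : Fin m → ℕ} → (∀ y → f y ≡ g y) → sumℕ T f ≡ sumℕ T g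
  sum-cong {zero}  f≗g = refl
  sum-cong {suc m} f≗g = cong₂ _+_ (f≗g zero) (sum-cong (f≗g ∘ suc))

  sum-zero : ∀ {m} {f : Fin m → ℕ} → (∀ y → f y ≡ 0) → sumℕ T f ≡ 0
  sum-zero {zero}  f≗0 = refl
  sum-zero {suc m} f≗0 = cong₂ _+_ (f≗0 zero) (sum-zero (f≗0 ∘ suc))

  sum-+ : ∀ {m} (f g : Fin m → ℕ) → sumℕ T (λ y → f y + g y) ≡ sumℕ T f + sumℕ T g
  sum-+ {zero}  f g = refl
  sum-+ {suc m} f g = trans (cong ((f zero + g zero) +_) (sum-+ (f ∘ suc) (g ∘ suc)))
    (solve 4 (λ a b c d → (a :+ b) :+ (c :+ d) := (a :+ c) :+ (b :+ d)) refl
           (f zero) (g zero) (sumℕ T (f ∘ suc)) (sumℕ T (g ∘ suc)))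
    where open +-*-Solver

  sum-mono : ∀ {m} {f g : Fin m → ℕ} → (∀ y → f y ≤ℕ g y) → sumℕ T f ≤ℕ sumℕ T g
  sum-mono {zero}  f≤g = z≤n
  sum-mono {suc m} f≤g = ℕ.+-mono-≤ (f≤g zero) (sum-mono (f≤g ∘ suc))

  sum-single : ∀ {m} (w : Fin m) a → sumℕ T (λ y → if does (y ≟ w) then a else 0) ≡ a
  sum-single {suc m} zero    a = trans (cong (a +_) (sum-zero {m} (λ _ → refl))) (ℕ.+-identityʳ a)
  sum-single {suc m} (suc w) a = sum-single w a

  sumℤ-mono-+ : ∀ {m} (f g : Fin m → ℤ) (h : Fin m → ℕ) →
    (∀ y → f y ≤ g y ℤ.+ ℤ.+ h y) → sumℤ T f ≤ sumℤ T g ℤ.+ ℤ.+ sumℕ T h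
  sumℤ-mono-+ {zero}  f g h f≤g+h = ℤ.≤-refl
  sumℤ-mono-+ {suc m} f g h f≤g+h = subst (sumℤ T f ≤_) regroup
    (ℤ.+-mono-≤ (f≤g+h zero) (sumℤ-mono-+ (f ∘ suc) (g ∘ suc) (h ∘ suc) (f≤g+h ∘ suc)))
    where
    open ℤSolver.+-*-Solver
    G = sumℤ T (g ∘ suc)
    H = sumℕ T (h ∘ suc)
    regroup : (g zero ℤ.+ ℤ.+ h zero) ℤ.+ (G ℤ.+ ℤ.+ H) ≡ (g zero ℤ.+ G) ℤ.+ ℤ.+ (h zero + H)
    regroup = trans (solve 4 (λ a b c d → (a :+ b) :+ (c :+ d) := (a :+ c) :+ (b :+ d)) refl
                           (g zero) (ℤ.+ h zero) G (ℤ.+ H))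
                    (cong (λ s → (g zero ℤ.+ G) ℤ.+ s) (sym (ℤ.pos-+ (h zero) H)))

  e : Fin n → Config T
  e v z = if eqb T z v then 1 else 0

  inflow : Fin n → Config T → ℕ
  inflow z c = sumℕ T (λ y → if adjb T z y then c y else 0)

  inflow-cong : ∀ z {c d : Config T} → (∀ y → c y ≡ d y) → inflow z c ≡ inflow z d
  inflow-cong z c≗d = sum-cong (λ y → cong (λ t → if adjb T z y then t else 0) (c≗d y))

  inflow-zero : ∀ z → inflow z (λ _ → 0) ≡ 0
  inflow-zero z = sum-zero (λ y → if-eta (adjb T z y))

  inflow-+ : ∀ z (c d : Config T) → inflow z (λ y → c y + d y) ≡ inflow z c + inflow z d
  inflow-+ z c d = trans (sum-cong split) (sum-+ (λ y → if adjb T z y then c y else 0) (λ y → if adjb T z y then d y else 0))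
    where
    split : ∀ y → (if adjb T z y then c y + d y else 0)
                ≡ (if adjb T z y then c y else 0) + (if adjb T z y then d y else 0)
    split y with adjb T z y
    ... | true  = refl
    ... | false = refl

  inflow-e : ∀ z w → inflow z (e w) ≡ (if adjb T z w then 1 else 0)
  inflow-e z w = trans (sum-cong at) (sum-single w _)
    where
    at : ∀ y → (if adjb T z y then e w y else 0) ≡ (if does (y ≟ w) then (if adjb T z w then 1 else 0) else 0)
    at y with y ≟ w
    ... | yes refl = refl
    ... | no _     = if-eta (adjb T z y)

  inflow-mono : ∀ z {c d : Config T} → (∀ y → c y ≤ℕ d y) → inflow z c ≤ℕ inflow z d
  inflow-mono z c≤d = sum-mono at
    where
    at : ∀ y → (if adjb T z y then _ else 0) ≤ℕ (if adjb T z y then _ else 0)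
    at y with adjb T z y
    ... | true  = c≤d y
    ... | false = z≤n

  -- τ = τ₀ − L c for the Laplacian L of the tree, with the subtraction moved to the left.
  Fired : Config T → Config T → Config T → Set
  Fired τ₀ c τ = ∀ z → τ z + c z * deg T z ≡ τ₀ z + inflow z c

  Fired-refl : ∀ τ → Fired τ (λ _ → 0) τ
  Fired-refl τ z = cong (τ z +_) (sym (inflow-zero z))

  fire-balance : ∀ {τ} w → deg T w ≤ℕ τ w →
    ∀ z → fire T w τ z + e w z * deg T z ≡ τ z + (if adjb T z w then 1 else 0)
  fire-balance {τ} w full z with z ≟ w
  ... | yes refl = begin
    τ z ∸ deg T z + (deg T z + 0)             ≡⟨ cong (τ z ∸ deg T z +_) (ℕ.+-identityʳ (deg T z)) ⟩
    τ z ∸ deg T z + deg T z                   ≡⟨ ℕ.m∸n+n≡m full ⟩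
    τ z                                       ≡⟨ ℕ.+-identityʳ (τ z) ⟨
    τ z + 0                                   ≡⟨ cong (λ b → τ z + (if b then 1 else 0)) (adj-irrefl z) ⟨
    τ z + (if adjb T z z then 1 else 0)       ∎
    where open ≡-Reasoning
  ... | no _ with adjb T z w
  ...   | true  = trans (ℕ.+-identityʳ _) (sym (ℕ.+-comm (τ z) 1))
  ...   | false = refl

  Fired-fire : ∀ {τ₀ c τ} w → deg T w ≤ℕ τ w → Fired τ₀ c τ → Fired τ₀ (λ y → c y + e w y) (fire T w τ)
  Fired-fire {τ₀} {c} {τ} w full fired z = begin
    fire T w τ z + (c z + e w z) * deg T z
      ≡⟨ cong (fire T w τ z +_) (ℕ.*-distribʳ-+ (deg T z) (c z) (e w z)) ⟩
    fire T w τ z + (c z * deg T z + e w z * deg T z)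
      ≡⟨ solve 3 (λ f a b → f :+ (a :+ b) := (f :+ b) :+ a) refl (fire T w τ z) (c z * deg T z) (e w z * deg T z) ⟩
    (fire T w τ z + e w z * deg T z) + c z * deg T z
      ≡⟨ cong (_+ c z * deg T z) (fire-balance w full z) ⟩
    (τ z + a) + c z * deg T z
      ≡⟨ solve 3 (λ t a b → (t :+ a) :+ b := (t :+ b) :+ a) refl (τ z) a (c z * deg T z) ⟩
    (τ z + c z * deg T z) + a
      ≡⟨ cong (_+ a) (fired z) ⟩
    (τ₀ z + inflow z c) + a
      ≡⟨ ℕ.+-assoc (τ₀ z) (inflow z c) a ⟩
    τ₀ z + (inflow z c + a)
      ≡⟨ cong (λ t → τ₀ z + (inflow z c + t)) (sym (inflow-e z w)) ⟩
    τ₀ z + (inflow z c + inflow z (e w))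
      ≡⟨ cong (τ₀ z +_) (sym (inflow-+ z c (e w))) ⟩
    τ₀ z + inflow z (λ y → c y + e w y) ∎
    where
    open ≡-Reasoning
    open +-*-Solver
    a = if adjb T z w then 1 else 0

  firingsFrom : ∀ {v τ τ′} → Config T → Reach T v τ τ′ → Config T
  firingsFrom c done           = c
  firingsFrom c (step w _ _ r) = firingsFrom (λ y → c y + e w y) r

  firings : ∀ {v τ τ′} → Reach T v τ τ′ → Config T
  firings = firingsFrom (λ _ → 0)

  Fired-firingsFrom : ∀ {v τ₀ c τ τ′} (r : Reach T v τ τ′) → Fired τ₀ c τ → Fired τ₀ (firingsFrom c r) τ′
  Fired-firingsFrom done                fired = fired
  Fired-firingsFrom (step w _ full r) fired = Fired-firingsFrom r (Fired-fire w full fired)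

  Fired-firings : ∀ {v τ τ′} (r : Reach T v τ τ′) → Fired τ (firings r) τ′
  Fired-firings {τ = τ} r = Fired-firingsFrom r (Fired-refl τ)

  firingsFrom-outside : ∀ {v τ τ′} (r : Reach T v τ τ′) c {z} → ¬ InSubtree T v z → firingsFrom c r z ≡ c z
  firingsFrom-outside done           c z∉ = refl
  firingsFrom-outside (step w w∈ _ r) c {z} z∉ =
    trans (firingsFrom-outside r _ z∉) (trans (cong (c z +_) e-w-z) (ℕ.+-identityʳ (c z)))
    where
    e-w-z : e w z ≡ 0
    e-w-z = cong (if_then 1 else 0) (dec-false (z ≟ w) (λ { refl → z∉ w∈ }))

  firings-outside : ∀ {v τ τ′} (r : Reach T v τ τ′) {z} → ¬ InSubtree T v z → firings r z ≡ 0
  firings-outside r = firingsFrom-outside r (λ _ → 0)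

  -- Least action principle: while c ≤ M, a vertex w that has fired M w times holds at most
  -- τ₀ w + inflow w M − M w · deg w < deg w chips, so it cannot fire again.
  least-action : ∀ {v τ₀ c τ τ′} (r : Reach T v τ τ′) {M : Config T} → Fired τ₀ c τ → (∀ y → c y ≤ℕ M y) →
    (∀ w → InSubtree T v w → τ₀ w + inflow w M <ℕ suc (M w) * deg T w) →
    ∀ y → firingsFrom c r y ≤ℕ M y
  least-action done _ c≤M _ = c≤M
  least-action {τ₀ = τ₀} {c} {τ} (step w w∈ full r) {M} fired c≤M stable =
    least-action r (Fired-fire w full fired) c+e≤M stable
    where
    open ℕ.≤-Reasoning
    c≢M : c w ≢ M w
    c≢M c≡M = ℕ.<-irrefl refl (begin-strict
      suc (M w) * deg T w     ≡⟨ cong (λ t → deg T w + t * deg T w) (sym c≡M) ⟩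
      deg T w + c w * deg T w ≤⟨ ℕ.+-monoˡ-≤ _ full ⟩
      τ w + c w * deg T w     ≡⟨ fired w ⟩
      τ₀ w + inflow w c       ≤⟨ ℕ.+-monoʳ-≤ (τ₀ w) (inflow-mono w c≤M) ⟩
      τ₀ w + inflow w M       <⟨ stable w w∈ ⟩
      suc (M w) * deg T w     ∎)
    c+e≤M : ∀ y → c y + e w y ≤ℕ M y
    c+e≤M y with y ≟ w
    ... | yes refl = subst (_≤ℕ M y) (ℕ.+-comm 1 (c y)) (ℕ.≤∧≢⇒< (c≤M y) c≢M)
    ... | no _     = subst (_≤ℕ M y) (sym (ℕ.+-identityʳ (c y))) (c≤M y)

  addAt-suc : ∀ σ k v z → addAt T σ (suc k) v z ≡ addAt T σ k v z + e v z
  addAt-suc σ k v z with z ≟ v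
  ... | yes _ = trans (ℕ.+-suc (σ z) k) (ℕ.+-comm 1 (σ z + k))
  ... | no _  = sym (ℕ.+-identityʳ (σ z))

  module _ {v : Fin n} (v≢root : v ≢ root) where

    parent≢self : parent v ≢ v
    parent≢self p≡v = parent∉subtree v≢root (0 , p≡v)

    inflow-parent : ∀ c → (∀ {y} → ¬ InSubtree T v y → c y ≡ 0) → inflow (parent v) c ≡ c v
    inflow-parent c supported = trans (sum-cong at) (sum-single v (c v))
      where
      at : ∀ y → (if adjb T (parent v) y then c y else 0) ≡ (if does (y ≟ v) then c v else 0)
      at y with y ≟ v
      ... | yes refl rewrite parent-adj v≢root = refl
      ... | no y≢v with adjb T (parent v) y in adj
      ...   | true  = supported (λ y∈ → y≢v (subtree-adj-parent v≢root y∈ adj))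
      ...   | false = refl

    final-parent : ∀ {τ τ′} (r : Reach T v τ τ′) → τ′ (parent v) ≡ τ (parent v) + firings r v
    final-parent {τ} {τ′} r = begin
      τ′ p                           ≡⟨ ℕ.+-identityʳ (τ′ p) ⟨
      τ′ p + 0                       ≡⟨ cong (λ t → τ′ p + t * deg T p) (firings-outside r (parent∉subtree v≢root)) ⟨
      τ′ p + firings r p * deg T p   ≡⟨ Fired-firings r p ⟩
      τ p + inflow p (firings r)     ≡⟨ cong (τ p +_) (inflow-parent (firings r) (firings-outside r)) ⟩
      τ p + firings r v              ∎
      where
      open ≡-Reasoning
      p = parent v

    adj-parent-in-subtree : ∀ {w} → InSubtree T v w → (if adjb T w (parent v) then 1 else 0) ≡ e v w
    adj-parent-in-subtree {w} w∈ with w ≟ v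
    ... | yes refl rewrite adj-sym w (parent w) | parent-adj v≢root = refl
    ... | no w≢v with adjb T w (parent v) in adj
    ...   | true  = contradiction (subtree-adj-parent v≢root w∈ (trans (adj-sym (parent v) w) adj)) w≢v
    ...   | false = refl

    final-parent-+1 : ∀ {τ τ⁺ A B} → (∀ z → τ⁺ z ≡ τ z + e v z) →
      (rA : Reach T v τ A) → LocalTerminal T v A → (rB : Reach T v τ⁺ B) →
      B (parent v) ≤ℕ A (parent v) + 1
    final-parent-+1 {τ} {τ⁺} {A} {B} τ⁺≗τ+e rA A-terminal rB = begin
      B p                          ≡⟨ final-parent rB ⟩
      τ⁺ p + firings rB v          ≡⟨ cong (_+ firings rB v) τ⁺-at-p ⟩
      τ p + firings rB v           ≤⟨ ℕ.+-monoʳ-≤ (τ p) (least-action rB (Fired-refl τ⁺) (λ _ → z≤n) stable v) ⟩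
      τ p + M v                    ≡⟨ cong (τ p +_) (M-in-subtree (0 , refl)) ⟩
      τ p + (cA v + 1)             ≡⟨ ℕ.+-assoc (τ p) (cA v) 1 ⟨
      τ p + cA v + 1               ≡⟨ cong (_+ 1) (final-parent rA) ⟨
      A p + 1                      ∎
      where
      open ℕ.≤-Reasoning
      p = parent v
      cA = firings rA
      notParent : Config T
      notParent y = if eqb T y p then 0 else 1
      M : Config T
      M y = cA y + notParent y

      τ⁺-at-p : τ⁺ p ≡ τ p
      τ⁺-at-p = trans (τ⁺≗τ+e p)
        (trans (cong (λ b → τ p + (if b then 1 else 0)) (dec-false (p ≟ v) parent≢self)) (ℕ.+-identityʳ (τ p)))

      M-in-subtree : ∀ {w} → InSubtree T v w → M w ≡ cA w + 1
      M-in-subtree {w} w∈ = cong (λ b → cA w + (if b then 0 else 1))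
        (dec-false (w ≟ p) (λ { refl → parent∉subtree v≢root w∈ }))

      -- p does not fire, and the chip it does not send to v is the one added at v.
      inflow-notParent : ∀ {w} → InSubtree T v w → inflow w notParent + e v w ≡ deg T w
      inflow-notParent {w} w∈ = ≡.begin
        inflow w notParent + e v w                ≡.≡⟨ cong (inflow w notParent +_)
                                                         (trans (sym (adj-parent-in-subtree w∈)) (sym (inflow-e w p))) ⟩
        inflow w notParent + inflow w (e p)       ≡.≡⟨ inflow-+ w notParent (e p) ⟨
        inflow w (λ y → notParent y + e p y)      ≡.≡⟨ inflow-cong w notParent+e≡1 ⟩
        deg T w                                   ≡.∎
        where
        module ≡ = ≡-Reasoning
        notParent+e≡1 : ∀ y → notParent y + e p y ≡ 1
        notParent+e≡1 y with y ≟ p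
        ... | yes _ = refl
        ... | no _  = refl

      stable : ∀ w → InSubtree T v w → τ⁺ w + inflow w M <ℕ suc (M w) * deg T w
      stable w w∈ = begin-strict
        τ⁺ w + inflow w M
          ≡⟨ cong₂ _+_ (τ⁺≗τ+e w) (inflow-+ w cA notParent) ⟩
        (τ w + e v w) + (inflow w cA + inflow w notParent)
          <⟨ one-more-round {c = cA w} {t = τ w} {e v w} {inflow w cA} {inflow w notParent}
               (A-terminal w w∈) (Fired-firings rA w) (inflow-notParent w∈) ⟩
        suc (cA w + 1) * deg T w
          ≡⟨ cong (λ t → suc t * deg T w) (M-in-subtree w∈) ⟨
        suc (M w) * deg T w ∎

  children≤deg : ∀ u → sumℕ T (λ y → if isChildb T u y then 1 else 0) ≤ℕ deg T u
  children≤deg u = sum-mono at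
    where
    at : ∀ y → (if isChildb T u y then 1 else 0) ≤ℕ (if adjb T u y then 1 else 0)
    at y with isChildb T u y
    ... | true  = ℕ.≤-refl
    ... | false = z≤n

−-mono-+1 : ∀ {a b} c → a ≤ℕ b + 1 → ℤ.+ a ℤ.- ℤ.+ c ≤ (ℤ.+ b ℤ.- ℤ.+ c) ℤ.+ ℤ.+ 1
−-mono-+1 {a} {b} c a≤b+1 = subst (ℤ.+ a ℤ.- ℤ.+ c ≤_) regroup (ℤ.+-monoˡ-≤ (ℤ.- ℤ.+ c) (ℤ.+≤+ a≤b+1))
  where
  open ℤSolver.+-*-Solver
  regroup : ℤ.+ (b + 1) ℤ.- ℤ.+ c ≡ (ℤ.+ b ℤ.- ℤ.+ c) ℤ.+ ℤ.+ 1
  regroup = trans (cong (ℤ._- ℤ.+ c) (ℤ.pos-+ b 1))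
                  (solve 3 (λ b c o → (b :+ o) :- c := (b :- c) :+ o) refl (ℤ.+ b) (ℤ.+ c) (ℤ.+ 1))

trade-≤ : ∀ s {d m k S₀ S₁} → k ≤ℕ d → S₁ ≤ S₀ ℤ.+ ℤ.+ k →
  ℤ.+ s ℤ.- ℤ.+ (d + m) ℤ.+ S₁ ≤ ℤ.+ s ℤ.- ℤ.+ m ℤ.+ S₀
trade-≤ s {d} {m} {k} {S₀} k≤d S₁≤S₀+k = ℤ.≤-trans
  (ℤ.+-monoʳ-≤ (ℤ.+ s ℤ.- ℤ.+ (d + m)) (ℤ.≤-trans S₁≤S₀+k (ℤ.+-monoʳ-≤ S₀ (ℤ.+≤+ k≤d))))
  (ℤ.≤-reflexive regroup)
  where
  open ℤSolver.+-*-Solver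
  regroup : ℤ.+ s ℤ.- ℤ.+ (d + m) ℤ.+ (S₀ ℤ.+ ℤ.+ d) ≡ ℤ.+ s ℤ.- ℤ.+ m ℤ.+ S₀
  regroup = trans (cong (λ t → ℤ.+ s ℤ.- t ℤ.+ (S₀ ℤ.+ ℤ.+ d)) (ℤ.pos-+ d m))
    (solve 4 (λ s d m z → s :- (d :+ m) :+ (z :+ d) := s :- m :+ z) refl (ℤ.+ s) (ℤ.+ d) (ℤ.+ m) S₀)

lemma3p5 : ∀ {n} (T : RootedTree n) (u : Fin n) (σ : Config T) →
    (∀ v → isChildb T u v ≡ true → LocalTerminal T v σ) →
    (fin : Fin n → ℕ → Config T) → (fin0 : Fin n → Config T) →
    (∀ v → isChildb T u v ≡ true → ∀ x → IsFinal T v (addAt T σ x v) (fin v x)) →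
    (∀ v → isChildb T u v ≡ true → IsFinal T v σ (fin0 v)) →
    ∀ k → ψ T σ u fin fin0 (suc k) ≤ ψ T σ u fin fin0 k
lemma3p5 T u σ _ fin fin0 final _ k =
  trade-≤ (σ u) (children≤deg T u) (sumℤ-mono-+ T _ _ _ δ-step)
  where
  δ-step : ∀ v → (if isChildb T u v then δ T v (fin v (suc k)) (fin0 v) else ℤ.+ 0)
               ≤ (if isChildb T u v then δ T v (fin v k) (fin0 v) else ℤ.+ 0)
                 ℤ.+ ℤ.+ (if isChildb T u v then 1 else 0)
  δ-step v with isChildb T u v in child
  ... | false = ℤ.≤-refl
  ... | true  = −-mono-+1 (fin0 v (RootedTree.parent T v))
    (final-parent-+1 T (isChild⇒nonroot T child) (addAt-suc T σ k v)
      (proj₁ (final v child k)) (proj₂ (final v child k)) (proj₁ (final v child (suc k))))
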